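{- Let $\lambda\ge1$ and $\delta\ge1$ be integers, and let the notation $B$, $N$, $\kappa_{\alpha}$, $R$, $\rho_\alpha$, $\nu$, $V$, $T_0,\dots,T_{2\nu}$ be as in the context. Let $a,b,h_1,\dots,h_\delta,k$ be nonnegative integers such that $k>|2T_\iota(a,h_1,\dots,h_\delta)|$ for all $\iota=0,\dots,2\nu$, and $b=B(h_1,\dots,h_\delta,k)$. Then $R(a,h_1,\dots,h_\delta)=0$ if and only if there exists an integer $z$ such that $$-k^\nu<2\bigl(V(k)(1+ak+b)^\lambda-z\,k^{\nu+1}\bigr)<k^\nu.$$
   Context: Define the polynomial $B(h_1,\dots,h_\delta,k)=\sum_{\iota=1}^{\delta}h_\iota k^{(\lambda+1)^\iota}$ and $N(l_0,\dots,l_\delta)=\sum_{\iota=0}^{\delta}l_\iota(\lambda+1)^\iota$. Expanding by the multinomial theorem one has the polynomial identity $$(1+ak+B(h_1,\dots,h_\delta,k))^\lambda=\sum_{\alpha_0+\dots+\alpha_\delta\le\lambda}\kappa_{\alpha_0,\dots,\alpha_\delta}\,a^{\alpha_0}h_1^{\alpha_1}\cdots h_\delta^{\alpha_\delta}k^{N(\alpha_0,\dots,\alpha_\delta)},$$ with positive integers $\kappa_{\alpha_0,\dots,\alpha_\delta}$ (sum over tuples of nonnegative integers). Let $\rho_{\alpha_0,\dots,\alpha_\delta}$ (for $\alpha_0+\dots+\alpha_\delta\le\lambda$) be integers and let $R(a,h_1,\dots,h_\delta)=\sum_{\alpha_0+\dots+\alpha_\delta\le\lambda}\rho_{\alpha_0,\dots,\alpha_\delta}\kappa_{\alpha_0,\dots,\alpha_\delta}a^{\alpha_0}h_1^{\alpha_1}\cdots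 h_\delta^{\alpha_\delta}$. Put $\nu=\lambda(\lambda+1)^\delta$ and $V(k)=\sum_{\alpha_0+\dots+\alpha_\delta\le\lambda}\rho_{\alpha_0,\dots,\alpha_\delta}k^{\nu-N(\alpha_0,\dots,\alpha_\delta)}$. The polynomials $T_0,\dots,T_{2\nu}$ in $a,h_1,\dots,h_\delta$ with integer coefficients are defined by the polynomial identity $V(k)(1+ak+B(h_1,\dots,h_\delta,k))^\lambda=\sum_{\iota=0}^{2\nu}T_\iota(a,h_1,\dots,h_\delta)k^\iota$. -}

module Defs where

open import Data.Nat as ℕ using (ℕ; zero; suc; NonZero; _!)
open import Data.Nat.Properties using (_!≢0; m*n≢0)
open import Data.Integer as ℤ using (ℤ; +_; 0ℤ; 1ℤ)
open import Data.List as List using (List; []; _∷_; [_]; _++_)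
open import Data.Vec as Vec using (Vec; []; _∷_)
open import Data.Fin using (Fin; toℕ)
open import Relation.Nullary.Decidable using (does)
open import Data.Bool using (if_then_else_)

-- Index tuples (α₀,…,α_d) of nonnegative integers with α₀+…+α_d ≤ l.
-- A tuple is a vector α : Vec ℕ (suc d), entry 0 is α₀ (exponent of a),
-- entry (suc i) is α_{i+1} (exponent of h_{i+1}).

boxVecs : (n m : ℕ) → List (Vec ℕ n)
boxVecs zero    m = [ [] ]
boxVecs (suc n) m =
  List.concatMap (λ i → List.map (i ∷_) (boxVecs n m)) (List.upTo (suc m))

Idx : (d l : ℕ) → List (Vec ℕ (suc d))
Idx d l = List.filter (λ α → Vec.sum α ℕ.≤? l) (boxVecs (suc d) l)

ΣIdx : (d l : ℕ) → (Vec ℕ (suc d) → ℤ) → ℤ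
ΣIdx d l f = List.foldr (λ α s → f α ℤ.+ s) 0ℤ (Idx d l)

N : (l : ℕ) {n : ℕ} → Vec ℕ n → ℕ
N l {n} xs = Vec.sum (Vec.tabulate {n = n} (λ i → Vec.lookup xs i ℕ.* (suc l) ℕ.^ toℕ i))

ν : (l d : ℕ) → ℕ
ν l d = l ℕ.* (suc l) ℕ.^ d

-- κ_α : multinomial coefficient  l! / ((l - Σα)! α₀! ⋯ α_d!),
-- the coefficient of a^{α₀} h₁^{α₁}⋯h_d^{α_d} k^{N(α)} in (1+ak+B)^l.

prodFact : {n : ℕ} → Vec ℕ n → ℕ
prodFact []       = 1
prodFact (x ∷ xs) = x ! ℕ.* prodFact xs

prodFact≢0 : {n : ℕ} (xs : Vec ℕ n) → NonZero (prodFact xs)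
prodFact≢0 []       = _
prodFact≢0 (x ∷ xs) = m*n≢0 (x !) (prodFact xs) {{x !≢0}} {{prodFact≢0 xs}}

multDen : (l : ℕ) {n : ℕ} → Vec ℕ n → ℕ
multDen l α = (l ℕ.∸ Vec.sum α) ! ℕ.* prodFact α

multDen≢0 : (l : ℕ) {n : ℕ} (α : Vec ℕ n) → NonZero (multDen l α)
multDen≢0 l α = m*n≢0 ((l ℕ.∸ Vec.sum α) !) (prodFact α) {{(l ℕ.∸ Vec.sum α) !≢0}} {{prodFact≢0 α}}

κ : (l : ℕ) {n : ℕ} → Vec ℕ n → ℕ
κ l α = ℕ._/_ (l !) (multDen l α) {{multDen≢0 l α}}

mono : {d : ℕ} → ℕ → Vec ℕ d → Vec ℕ (suc d) → ℤ
mono a h α = + Vec.foldr _ ℕ._*_ 1 (Vec.zipWith ℕ._^_ (a ∷ h) α)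

R : (l d : ℕ) → (Vec ℕ (suc d) → ℤ) → ℕ → Vec ℕ d → ℤ
R l d ρ a h = ΣIdx d l (λ α → ρ α ℤ.* + κ l α ℤ.* mono a h α)

-- B(h₁,…,h_d,k) = Σ_{ι=1}^{d} h_ι k^{(l+1)^ι}   (h_ι = lookup h (ι-1))
B : (l : ℕ) {d : ℕ} → Vec ℕ d → ℕ → ℕ
B l {d} h k = Vec.sum (Vec.tabulate {n = d} (λ i → Vec.lookup h i ℕ.* k ℕ.^ ((suc l) ℕ.^ suc (toℕ i))))

V : (l d : ℕ) → (Vec ℕ (suc d) → ℤ) → ℕ → ℤ
V l d ρ k = ΣIdx d l (λ α → ρ α ℤ.* (+ k) ℤ.^ (ν l d ℕ.∸ N l α))

-- Univariate polynomials in k with integer coefficients, as coefficient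
-- lists (lowest degree first).

Poly : Set
Poly = List ℤ

infixl 6 _⊕_
infixl 7 _⊗_

_⊕_ : Poly → Poly → Poly
[]      ⊕ q       = q
(x ∷ p) ⊕ []      = x ∷ p
(x ∷ p) ⊕ (y ∷ q) = (x ℤ.+ y) ∷ (p ⊕ q)

scale : ℤ → Poly → Poly
scale c p = List.map (c ℤ.*_) p

_⊗_ : Poly → Poly → Poly
[]      ⊗ q = []
(x ∷ p) ⊗ q = scale x q ⊕ (0ℤ ∷ (p ⊗ q))

pow : Poly → ℕ → Poly
pow p zero    = [ 1ℤ ]
pow p (suc n) = p ⊗ pow p n

monomial : ℤ → ℕ → Poly
monomial c n = List.replicate n 0ℤ ++ [ c ]

coeff : Poly → ℕ → ℤ
coeff []      i       = 0ℤ
coeff (x ∷ p) zero    = x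
coeff (x ∷ p) (suc i) = coeff p i

polySum : List Poly → Poly
polySum = List.foldr _⊕_ []

Vpoly : (l d : ℕ) → (Vec ℕ (suc d) → ℤ) → Poly
Vpoly l d ρ = polySum (List.map (λ α → monomial (ρ α) (ν l d ℕ.∸ N l α)) (Idx d l))

basePoly : (l : ℕ) {d : ℕ} → ℕ → Vec ℕ d → Poly
basePoly l {d} a h =
  monomial 1ℤ 0 ⊕ monomial (+ a) 1 ⊕
  polySum (Vec.toList (Vec.tabulate {n = d}
    (λ i → monomial (+ Vec.lookup h i) ((suc l) ℕ.^ suc (toℕ i)))))

T : (l d : ℕ) → (Vec ℕ (suc d) → ℤ) → ℕ → Vec ℕ d → ℕ → ℤ
T l d ρ a h ι = coeff (Vpoly l d ρ ⊗ pow (basePoly l a h) l) ι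

module Submission where

-- The theorem says: writing V(k)(1+ak+b)^λ = Σ_ι T_ι k^ι with balanced digits |2T_ι| < k,
-- the "digit" T_ν vanishes exactly when the number V(k)(1+ak+b)^λ lies strictly within
-- k^ν/2 of a multiple of k^{ν+1}; and T_ν is precisely R(a,h).  Accordingly the file has
-- three independent parts, all phrased for coefficient lists (polynomials in k):
--   * evaluation at k is a ring homomorphism, so the coefficient list V·(1+ak+B)^λ
--     evaluates to the integer V(k)(1+ak+b)^λ;
--   * coefficient extraction: (1+ak+B)^λ = (ak + Q(k^{λ+1}))^λ with
--     Q = 1 + h₁k + h₂k^{λ+1} + ⋯ of the same shape, and since every exponent below
--     λ+1 stays in its own residue class mod λ+1 the binomial theorem peels off one
--     variable at a time; the coefficient of k^{N(α)} is the multinomial coefficient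
--     κ_α a^{α₀}h^{α}, and summing against V gives T_ν = R (as N(α) ≤ ν);
--   * a digit lemma for balanced base-k expansions.
-- Coefficient lists are studied through their coefficient sequences (ℕ → ℤ), where
-- products become Cauchy convolutions and k ↦ k^{c+1} becomes a "stretch".

open import Defs
open import Data.Nat as ℕ using (ℕ; zero; suc; _≤_; _<_; z≤n; s≤s; _∸_; _!)
import Data.Nat.Properties as ℕP
import Data.Nat.Tactic.RingSolver as ℕSolver
open import Data.Nat.Combinatorics
  using (_C_; k>n⇒nCk≡0; nCk+nC[k+1]≡[n+1]C[k+1]; nCk≡n!/k![n-k]!; k![n∸k]!∣n!)
open import Data.Nat.DivMod using (m/n*n≡m; m*n/n≡m)
open import Data.Integer as ℤ using (ℤ; +_; -[1+_]; 0ℤ; 1ℤ; ∣_∣; _+_; _*_; _-_; -_; _^_)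
import Data.Integer.Properties as ℤP
open import Algebra.Properties.CommutativeSemigroup ℤP.*-commutativeSemigroup using (x∙yz≈y∙xz)
open import Data.Integer.Tactic.RingSolver using (solve-∀)
open import Data.List as List using (List; []; _∷_; [_]; _++_)
open import Data.List.Relation.Unary.All using (All; []; _∷_)
open import Data.List.Relation.Unary.All.Properties using (all-filter)
open import Data.Vec as Vec using (Vec; []; _∷_)
import Data.Vec.Properties as VecP
open import Data.Fin as Fin using (Fin; toℕ)
open import Data.Product using (∃; _×_; _,_)
open import Function using (_∘_)
open import Function.Bundles using (_⇔_; mk⇔)
open import Relation.Binary.PropositionalEquality
  using (_≡_; refl; sym; trans; cong; cong₂; subst; subst₂; _≗_; module ≡-Reasoning)
open import Relation.Nullary using (yes; no)

-- n ↦ coefficient of kⁿ; the view in which products and substitutions are computed.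
Series : Set
Series = ℕ → ℤ

unit : Series
unit = coeff [ 1ℤ ]

linear : ℤ → Series
linear a = coeff (monomial a 1)

conv : Series → Series → Series
conv f g zero    = f 0 * g 0
conv f g (suc n) = f 0 * g (suc n) + conv (f ∘ suc) g n

power : Series → ℕ → Series
power f zero    = unit
power f (suc m) = conv f (power f m)

conv-cong : ∀ {f f′ g g′} → f ≗ f′ → g ≗ g′ → conv f g ≗ conv f′ g′
conv-cong f≗ g≗ zero    = cong₂ _*_ (f≗ 0) (g≗ 0)
conv-cong f≗ g≗ (suc n) = cong₂ _+_ (cong₂ _*_ (f≗ 0) (g≗ (suc n))) (conv-cong (f≗ ∘ suc) g≗ n)

conv-zeroˡ : ∀ g n → conv (λ _ → 0ℤ) g n ≡ 0ℤ
conv-zeroˡ g zero    = refl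
conv-zeroˡ g (suc n) = trans (ℤP.+-identityˡ _) (conv-zeroˡ g n)

conv-distribʳ : ∀ f f′ g n → conv (λ i → f i + f′ i) g n ≡ conv f g n + conv f′ g n
conv-distribʳ f f′ g zero    = ℤP.*-distribʳ-+ (g 0) (f 0) (f′ 0)
conv-distribʳ f f′ g (suc n) = begin
  (f 0 + f′ 0) * g (suc n) + conv (λ i → f (suc i) + f′ (suc i)) g n
    ≡⟨ cong₂ _+_ (ℤP.*-distribʳ-+ (g (suc n)) (f 0) (f′ 0)) (conv-distribʳ (f ∘ suc) (f′ ∘ suc) g n) ⟩
  (f 0 * g (suc n) + f′ 0 * g (suc n)) + (conv (f ∘ suc) g n + conv (f′ ∘ suc) g n)
    ≡⟨ swap-middle (f 0 * g (suc n)) (f′ 0 * g (suc n)) (conv (f ∘ suc) g n) (conv (f′ ∘ suc) g n) ⟩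
  (f 0 * g (suc n) + conv (f ∘ suc) g n) + (f′ 0 * g (suc n) + conv (f′ ∘ suc) g n) ∎
  where
  open ≡-Reasoning
  swap-middle : ∀ a b c d → (a + b) + (c + d) ≡ (a + c) + (b + d)
  swap-middle = solve-∀

conv-scaleʳ : ∀ f c g n → conv f (λ i → c * g i) n ≡ c * conv f g n
conv-scaleʳ f c g zero    = x∙yz≈y∙xz (f 0) c (g 0)
conv-scaleʳ f c g (suc n) = begin
  f 0 * (c * g (suc n)) + conv (f ∘ suc) (λ i → c * g i) n
    ≡⟨ cong₂ _+_ (x∙yz≈y∙xz (f 0) c (g (suc n))) (conv-scaleʳ (f ∘ suc) c g n) ⟩
  c * (f 0 * g (suc n)) + c * conv (f ∘ suc) g n
    ≡⟨ sym (ℤP.*-distribˡ-+ c _ _) ⟩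
  c * (f 0 * g (suc n) + conv (f ∘ suc) g n) ∎
  where open ≡-Reasoning

conv-linear : ∀ a g n → conv (linear a) g (suc n) ≡ a * g n
conv-linear a g zero    = ℤP.+-identityˡ _
conv-linear a g (suc n) = begin
  0ℤ * g (suc (suc n)) + (a * g (suc n) + conv (λ _ → 0ℤ) g n)
    ≡⟨ ℤP.+-identityˡ _ ⟩
  a * g (suc n) + conv (λ _ → 0ℤ) g n
    ≡⟨ cong (λ t → a * g (suc n) + t) (conv-zeroˡ g n) ⟩
  a * g (suc n) + 0ℤ
    ≡⟨ ℤP.+-identityʳ _ ⟩
  a * g (suc n) ∎
  where open ≡-Reasoning

coeff-⊕ : ∀ p q n → coeff (p ⊕ q) n ≡ coeff p n + coeff q n
coeff-⊕ []      q       n       = sym (ℤP.+-identityˡ _)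
coeff-⊕ (x ∷ p) []      n       = sym (ℤP.+-identityʳ _)
coeff-⊕ (x ∷ p) (y ∷ q) zero    = refl
coeff-⊕ (x ∷ p) (y ∷ q) (suc n) = coeff-⊕ p q n

coeff-scale : ∀ c q n → coeff (scale c q) n ≡ c * coeff q n
coeff-scale c []      n       = sym (ℤP.*-zeroʳ c)
coeff-scale c (x ∷ q) zero    = refl
coeff-scale c (x ∷ q) (suc n) = coeff-scale c q n

coeff-⊗ : ∀ p q → coeff (p ⊗ q) ≗ conv (coeff p) (coeff q)
coeff-⊗ []      q n       = sym (conv-zeroˡ (coeff q) n)
coeff-⊗ (x ∷ p) q zero    = begin
  coeff (scale x q ⊕ (0ℤ ∷ (p ⊗ q))) 0 ≡⟨ coeff-⊕ (scale x q) _ 0 ⟩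
  coeff (scale x q) 0 + 0ℤ              ≡⟨ ℤP.+-identityʳ _ ⟩
  coeff (scale x q) 0                   ≡⟨ coeff-scale x q 0 ⟩
  x * coeff q 0                         ∎
  where open ≡-Reasoning
coeff-⊗ (x ∷ p) q (suc n) = begin
  coeff (scale x q ⊕ (0ℤ ∷ (p ⊗ q))) (suc n)   ≡⟨ coeff-⊕ (scale x q) _ (suc n) ⟩
  coeff (scale x q) (suc n) + coeff (p ⊗ q) n  ≡⟨ cong₂ _+_ (coeff-scale x q (suc n)) (coeff-⊗ p q n) ⟩
  x * coeff q (suc n) + conv (coeff p) (coeff q) n ∎
  where open ≡-Reasoning

coeff-pow : ∀ p {f} → coeff p ≗ f → ∀ m → coeff (pow p m) ≗ power f m
coeff-pow p p≗f zero    n = refl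
coeff-pow p p≗f (suc m) n = trans (coeff-⊗ p (pow p m) n) (conv-cong p≗f (coeff-pow p p≗f m) n)

coeff-monomial-⊗ : ∀ c e q j → coeff (monomial c e ⊗ q) (e ℕ.+ j) ≡ c * coeff q j
coeff-monomial-⊗ c zero    q j = begin
  coeff (scale c q ⊕ [ 0ℤ ]) j     ≡⟨ coeff-⊕ (scale c q) [ 0ℤ ] j ⟩
  coeff (scale c q) j + coeff [ 0ℤ ] j ≡⟨ cong₂ _+_ (coeff-scale c q j) (coeff-zero j) ⟩
  c * coeff q j + 0ℤ               ≡⟨ ℤP.+-identityʳ _ ⟩
  c * coeff q j                    ∎
  where
  open ≡-Reasoning
  coeff-zero : ∀ j → coeff [ 0ℤ ] j ≡ 0ℤ
  coeff-zero zero    = refl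
  coeff-zero (suc j) = refl
coeff-monomial-⊗ c (suc e) q j = begin
  coeff (scale 0ℤ q ⊕ (0ℤ ∷ (monomial c e ⊗ q))) (suc (e ℕ.+ j))
    ≡⟨ coeff-⊕ (scale 0ℤ q) _ (suc (e ℕ.+ j)) ⟩
  coeff (scale 0ℤ q) (suc (e ℕ.+ j)) + coeff (monomial c e ⊗ q) (e ℕ.+ j)
    ≡⟨ cong₂ _+_ (coeff-scale 0ℤ q _) (coeff-monomial-⊗ c e q j) ⟩
  0ℤ * coeff q (suc (e ℕ.+ j)) + c * coeff q j
    ≡⟨ ℤP.+-identityˡ _ ⟩
  c * coeff q j ∎
  where open ≡-Reasoning

coeff-polySum-⊗ : ∀ {A : Set} (xs : List A) (F : A → Poly) q n →
  coeff (polySum (List.map F xs) ⊗ q) n ≡ List.foldr (λ α s → coeff (F α ⊗ q) n + s) 0ℤ xs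
coeff-polySum-⊗ []       F q n = refl
coeff-polySum-⊗ (x ∷ xs) F q n = begin
  coeff ((F x ⊕ S) ⊗ q) n                            ≡⟨ coeff-⊗ (F x ⊕ S) q n ⟩
  conv (coeff (F x ⊕ S)) (coeff q) n                 ≡⟨ conv-cong (coeff-⊕ (F x) S) (λ _ → refl) n ⟩
  conv (λ i → coeff (F x) i + coeff S i) (coeff q) n ≡⟨ conv-distribʳ (coeff (F x)) (coeff S) (coeff q) n ⟩
  conv (coeff (F x)) (coeff q) n + conv (coeff S) (coeff q) n
    ≡⟨ cong₂ _+_ (sym (coeff-⊗ (F x) q n)) (trans (sym (coeff-⊗ S q n)) (coeff-polySum-⊗ xs F q n)) ⟩
  coeff (F x ⊗ q) n + List.foldr (λ α s → coeff (F α ⊗ q) n + s) 0ℤ xs ∎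
  where
  open ≡-Reasoning
  S = polySum (List.map F xs)

eval : Poly → ℤ → ℤ
eval []      x = 0ℤ
eval (c ∷ p) x = c + x * eval p x

eval-⊕ : ∀ p q x → eval (p ⊕ q) x ≡ eval p x + eval q x
eval-⊕ []      q       x = sym (ℤP.+-identityˡ _)
eval-⊕ (c ∷ p) []      x = sym (ℤP.+-identityʳ _)
eval-⊕ (c ∷ p) (d ∷ q) x =
  trans (cong (λ t → c + d + x * t) (eval-⊕ p q x)) (regroup c d x (eval p x) (eval q x))
  where
  regroup : ∀ c d x u v → c + d + x * (u + v) ≡ c + x * u + (d + x * v)
  regroup = solve-∀

eval-scale : ∀ c q x → eval (scale c q) x ≡ c * eval q x
eval-scale c []      x = sym (ℤP.*-zeroʳ c)
eval-scale c (d ∷ q) x =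
  trans (cong (λ t → c * d + x * t) (eval-scale c q x)) (regroup c d x (eval q x))
  where
  regroup : ∀ c d x u → c * d + x * (c * u) ≡ c * (d + x * u)
  regroup = solve-∀

eval-⊗ : ∀ p q x → eval (p ⊗ q) x ≡ eval p x * eval q x
eval-⊗ []      q x = refl
eval-⊗ (c ∷ p) q x = begin
  eval (scale c q ⊕ (0ℤ ∷ (p ⊗ q))) x          ≡⟨ eval-⊕ (scale c q) _ x ⟩
  eval (scale c q) x + (0ℤ + x * eval (p ⊗ q) x) ≡⟨ cong₂ (λ u v → u + (0ℤ + x * v)) (eval-scale c q x) (eval-⊗ p q x) ⟩
  c * eval q x + (0ℤ + x * (eval p x * eval q x)) ≡⟨ regroup c x (eval p x) (eval q x) ⟩
  (c + x * eval p x) * eval q x                 ∎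
  where
  open ≡-Reasoning
  regroup : ∀ c x u v → c * v + (0ℤ + x * (u * v)) ≡ (c + x * u) * v
  regroup = solve-∀

eval-pow : ∀ p m x → eval (pow p m) x ≡ eval p x ^ m
eval-pow p zero    x = cong (λ t → 1ℤ + t) (ℤP.*-zeroʳ x)
eval-pow p (suc m) x = trans (eval-⊗ p (pow p m) x) (cong (λ t → eval p x * t) (eval-pow p m x))

eval-monomial : ∀ c n x → eval (monomial c n) x ≡ c * x ^ n
eval-monomial c zero    x = trans (cong (λ t → c + t) (ℤP.*-zeroʳ x)) (trans (ℤP.+-identityʳ c) (sym (ℤP.*-identityʳ c)))
eval-monomial c (suc n) x =
  trans (cong (λ t → 0ℤ + x * t) (eval-monomial c n x)) (regroup c x (x ^ n))
  where
  regroup : ∀ c x y → 0ℤ + x * (c * y) ≡ c * (x * y)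
  regroup = solve-∀

eval-polySum : ∀ {A : Set} (xs : List A) (F : A → Poly) x →
  eval (polySum (List.map F xs)) x ≡ List.foldr (λ α s → eval (F α) x + s) 0ℤ xs
eval-polySum []       F x = refl
eval-polySum (α ∷ xs) F x =
  trans (eval-⊕ (F α) _ x) (cong (λ t → eval (F α) x + t) (eval-polySum xs F x))

pos-^ : ∀ a n → (+ a) ^ n ≡ + (a ℕ.^ n)
pos-^ a zero    = refl
pos-^ a (suc n) = trans (cong (λ t → + a * t) (pos-^ a n)) (sym (ℤP.pos-* a (a ℕ.^ n)))

monomialSum : ∀ {d} → (Fin d → ℤ) → (Fin d → ℕ) → Poly
monomialSum F E = polySum (Vec.toList (Vec.tabulate (λ i → monomial (F i) (E i))))

eval-monomialSum : ∀ {d} (g E : Fin d → ℕ) k →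
  eval (monomialSum (λ i → + g i) E) (+ k) ≡ + Vec.sum (Vec.tabulate (λ i → g i ℕ.* k ℕ.^ E i))
eval-monomialSum {zero}  g E k = refl
eval-monomialSum {suc d} g E k = begin
  eval (monomial (+ g Fin.zero) (E Fin.zero) ⊕ rest) (+ k)
    ≡⟨ eval-⊕ (monomial (+ g Fin.zero) (E Fin.zero)) rest (+ k) ⟩
  eval (monomial (+ g Fin.zero) (E Fin.zero)) (+ k) + eval rest (+ k)
    ≡⟨ cong₂ _+_ first (eval-monomialSum (g ∘ Fin.suc) (E ∘ Fin.suc) k) ⟩
  + (g Fin.zero ℕ.* k ℕ.^ E Fin.zero) + + Vec.sum (Vec.tabulate (λ i → g (Fin.suc i) ℕ.* k ℕ.^ E (Fin.suc i)))
    ≡⟨ sym (ℤP.pos-+ (g Fin.zero ℕ.* k ℕ.^ E Fin.zero) _) ⟩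
  + Vec.sum (Vec.tabulate (λ i → g i ℕ.* k ℕ.^ E i)) ∎
  where
  open ≡-Reasoning
  rest = monomialSum (λ i → + g (Fin.suc i)) (E ∘ Fin.suc)
  first : eval (monomial (+ g Fin.zero) (E Fin.zero)) (+ k) ≡ + (g Fin.zero ℕ.* k ℕ.^ E Fin.zero)
  first = begin
    eval (monomial (+ g Fin.zero) (E Fin.zero)) (+ k) ≡⟨ eval-monomial (+ g Fin.zero) (E Fin.zero) (+ k) ⟩
    + g Fin.zero * (+ k) ^ E Fin.zero                ≡⟨ cong (λ t → + g Fin.zero * t) (pos-^ k (E Fin.zero)) ⟩
    + g Fin.zero * + (k ℕ.^ E Fin.zero)              ≡⟨ sym (ℤP.pos-* (g Fin.zero) _) ⟩
    + (g Fin.zero ℕ.* k ℕ.^ E Fin.zero)              ∎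

eval-basePoly : ∀ l a {d} (h : Vec ℕ d) k → eval (basePoly l a h) (+ k) ≡ + 1 + + a * + k + + B l h k
eval-basePoly l a h k = begin
  eval (monomial 1ℤ 0 ⊕ monomial (+ a) 1 ⊕ hs) (+ k)
    ≡⟨ eval-⊕ (monomial 1ℤ 0 ⊕ monomial (+ a) 1) hs (+ k) ⟩
  eval (monomial 1ℤ 0 ⊕ monomial (+ a) 1) (+ k) + eval hs (+ k)
    ≡⟨ cong₂ _+_ (eval-⊕ (monomial 1ℤ 0) (monomial (+ a) 1) (+ k)) (eval-monomialSum (Vec.lookup h) _ k) ⟩
  eval (monomial 1ℤ 0) (+ k) + eval (monomial (+ a) 1) (+ k) + + B l h k
    ≡⟨ cong₂ (λ u v → u + v + + B l h k) (eval-monomial 1ℤ 0 (+ k)) (eval-monomial (+ a) 1 (+ k)) ⟩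
  1ℤ * 1ℤ + + a * (+ k * 1ℤ) + + B l h k
    ≡⟨ regroup (+ a) (+ k) (+ B l h k) ⟩
  + 1 + + a * + k + + B l h k ∎
  where
  open ≡-Reasoning
  hs = monomialSum (λ i → + Vec.lookup h i) (λ i → suc l ℕ.^ suc (toℕ i))
  regroup : ∀ a k b → 1ℤ * 1ℤ + a * (k * 1ℤ) + b ≡ 1ℤ + a * k + b
  regroup = solve-∀

eval-Vpoly : ∀ l d ρ k → eval (Vpoly l d ρ) (+ k) ≡ V l d ρ k
eval-Vpoly l d ρ k = trans (eval-polySum (Idx d l) _ (+ k)) (termwise (Idx d l))
  where
  term : Vec ℕ (suc d) → Poly
  term α = monomial (ρ α) (ν l d ∸ N l α)
  termwise : ∀ xs → List.foldr (λ α s → eval (term α) (+ k) + s) 0ℤ xs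
                  ≡ List.foldr (λ α s → ρ α * (+ k) ^ (ν l d ∸ N l α) + s) 0ℤ xs
  termwise []       = refl
  termwise (α ∷ xs) = cong₂ _+_ (eval-monomial (ρ α) (ν l d ∸ N l α) (+ k)) (termwise xs)

eval-product : ∀ l d ρ a (h : Vec ℕ d) k →
  eval (Vpoly l d ρ ⊗ pow (basePoly l a h) l) (+ k) ≡ V l d ρ k * (+ 1 + + a * + k + + B l h k) ^ l
eval-product l d ρ a h k = begin
  eval (Vpoly l d ρ ⊗ pow (basePoly l a h) l) (+ k)          ≡⟨ eval-⊗ (Vpoly l d ρ) _ (+ k) ⟩
  eval (Vpoly l d ρ) (+ k) * eval (pow (basePoly l a h) l) (+ k)
    ≡⟨ cong₂ _*_ (eval-Vpoly l d ρ k) (eval-pow (basePoly l a h) l (+ k)) ⟩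
  V l d ρ k * eval (basePoly l a h) (+ k) ^ l                 ≡⟨ cong (λ t → V l d ρ k * t ^ l) (eval-basePoly l a h k) ⟩
  V l d ρ k * (+ 1 + + a * + k + + B l h k) ^ l               ∎
  where open ≡-Reasoning

mutual
  -- stretch c f: coefficients of f(k^{c+1}); fᵢ moves to position i(c+1), zeros elsewhere.
  stretch : ℕ → Series → Series
  stretch c f zero    = f 0
  stretch c f (suc n) = gap c c (f ∘ suc) n

  gap : ℕ → ℕ → Series → Series
  gap c zero    g n       = stretch c g n
  gap c (suc j) g zero    = 0ℤ
  gap c (suc j) g (suc n) = gap c j g n

mutual
  stretch-cong : ∀ c {f g} → f ≗ g → stretch c f ≗ stretch c g
  stretch-cong c f≗g zero    = f≗g 0
  stretch-cong c f≗g (suc n) = gap-cong c c (f≗g ∘ suc) n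

  gap-cong : ∀ c j {f g} → f ≗ g → gap c j f ≗ gap c j g
  gap-cong c zero    f≗g n       = stretch-cong c f≗g n
  gap-cong c (suc j) f≗g zero    = refl
  gap-cong c (suc j) f≗g (suc n) = gap-cong c j f≗g n

mutual
  stretch-+ : ∀ c f g n → stretch c (λ i → f i + g i) n ≡ stretch c f n + stretch c g n
  stretch-+ c f g zero    = refl
  stretch-+ c f g (suc n) = gap-+ c c (f ∘ suc) (g ∘ suc) n

  gap-+ : ∀ c j f g n → gap c j (λ i → f i + g i) n ≡ gap c j f n + gap c j g n
  gap-+ c zero    f g n       = stretch-+ c f g n
  gap-+ c (suc j) f g zero    = refl
  gap-+ c (suc j) f g (suc n) = gap-+ c j f g n

mutual
  stretch-zero : ∀ c n → stretch c (λ _ → 0ℤ) n ≡ 0ℤ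
  stretch-zero c zero    = refl
  stretch-zero c (suc n) = gap-zero c c n

  gap-zero : ∀ c j n → gap c j (λ _ → 0ℤ) n ≡ 0ℤ
  gap-zero c zero    n       = stretch-zero c n
  gap-zero c (suc j) zero    = refl
  gap-zero c (suc j) (suc n) = gap-zero c j n

gap-prefix : ∀ c g L → stretch c g ≗ coeff L → ∀ j → gap c j g ≗ coeff (List.replicate j 0ℤ ++ L)
gap-prefix c g L eq zero    n       = eq n
gap-prefix c g L eq (suc j) zero    = refl
gap-prefix c g L eq (suc j) (suc n) = gap-prefix c g L eq j n

replicate-+ : ∀ (a b : ℕ) (L : List ℤ) →
  List.replicate (a ℕ.+ b) 0ℤ ++ L ≡ List.replicate a 0ℤ ++ (List.replicate b 0ℤ ++ L)
replicate-+ zero    b L = refl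
replicate-+ (suc a) b L = cong (0ℤ ∷_) (replicate-+ a b L)

stretch-monomial : ∀ c x e → stretch c (coeff (monomial x e)) ≗ coeff (monomial x (e ℕ.* suc c))
stretch-monomial c x zero    zero    = refl
stretch-monomial c x zero    (suc n) = gap-zero c c n
stretch-monomial c x (suc e) zero    = refl
stretch-monomial c x (suc e) (suc n) =
  trans (gap-prefix c (coeff (monomial x e)) (monomial x (e ℕ.* suc c)) (stretch-monomial c x e) c n)
        (cong (λ L → coeff L n) (sym (replicate-+ c (e ℕ.* suc c) [ x ])))

-- The stretched series gap c (j+1) F has its first j+1 coefficients zero, so it
-- contributes nothing to a product below degree j+1.
conv-gap-low : ∀ c j F g n → n ≤ j → conv (gap c (suc j) F) g n ≡ 0ℤ
conv-gap-low c j       F g zero    _         = refl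
conv-gap-low c (suc j) F g (suc n) (s≤s n≤j) = trans (ℤP.+-identityˡ _) (conv-gap-low c j F g n n≤j)

conv-gap-shift : ∀ c j F g n → conv (gap c j F) g (j ℕ.+ n) ≡ conv (stretch c F) g n
conv-gap-shift c zero    F g n = refl
conv-gap-shift c (suc j) F g n = trans (ℤP.+-identityˡ _) (conv-gap-shift c j F g n)

-- Decimation: for r ≤ c, the coefficient of k^{r+q(c+1)} in f(k^{c+1})·g(k) only sees
-- the coefficients of g in the residue class r mod c+1.
conv-stretch : ∀ c f g r → r ≤ c → ∀ q →
  conv (stretch c f) g (r ℕ.+ q ℕ.* suc c) ≡ conv f (λ t → g (r ℕ.+ t ℕ.* suc c)) q
conv-stretch c f g zero    r≤c zero = refl
conv-stretch (suc c) f g (suc r) (s≤s r≤c) zero = begin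
  f 0 * g (suc (r ℕ.+ 0)) + conv (gap (suc c) (suc c) (f ∘ suc)) g (r ℕ.+ 0)
    ≡⟨ cong (λ t → f 0 * g (suc (r ℕ.+ 0)) + t) (conv-gap-low (suc c) _ (f ∘ suc) g (r ℕ.+ 0) r+0≤c) ⟩
  f 0 * g (suc (r ℕ.+ 0)) + 0ℤ
    ≡⟨ ℤP.+-identityʳ _ ⟩
  f 0 * g (suc (r ℕ.+ 0)) ∎
  where
  open ≡-Reasoning
  r+0≤c : r ℕ.+ 0 ≤ c
  r+0≤c = subst (_≤ c) (sym (ℕP.+-identityʳ r)) r≤c
conv-stretch c f g r r≤c (suc q) = begin
  conv (stretch c f) g (r ℕ.+ suc (c ℕ.+ q ℕ.* suc c))
    ≡⟨ cong (conv (stretch c f) g) index ⟩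
  f 0 * g (suc (c ℕ.+ m)) + conv (gap c c (f ∘ suc)) g (c ℕ.+ m)
    ≡⟨ cong₂ (λ i t → f 0 * g i + t) (sym index) (conv-gap-shift c c (f ∘ suc) g m) ⟩
  f 0 * g (r ℕ.+ suc q ℕ.* suc c) + conv (stretch c (f ∘ suc)) g m
    ≡⟨ cong (λ t → f 0 * g (r ℕ.+ suc q ℕ.* suc c) + t) (conv-stretch c (f ∘ suc) g r r≤c q) ⟩
  conv f (λ t → g (r ℕ.+ t ℕ.* suc c)) (suc q) ∎
  where
  open ≡-Reasoning
  m = r ℕ.+ q ℕ.* suc c
  swap : ∀ x y z → x ℕ.+ (y ℕ.+ z) ≡ y ℕ.+ (x ℕ.+ z)
  swap = ℕSolver.solve-∀
  index : r ℕ.+ suc (c ℕ.+ q ℕ.* suc c) ≡ suc (c ℕ.+ m)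
  index = trans (ℕP.+-suc r _) (cong suc (swap r c (q ℕ.* suc c)))

-- If r < m then m ∸ r = 1 + (m ∸ (r+1)); otherwise m C (r+1) vanishes.  Either way:
binomial-∸ : ∀ m r (F : ℕ → ℤ) → + (m C suc r) * F (suc (m ∸ suc r)) ≡ + (m C suc r) * F (m ∸ r)
binomial-∸ m r F with r ℕ.<? m
... | yes r<m = cong (λ j → + (m C suc r) * F j) (sym (ℕP.+-∸-assoc 1 r<m))
... | no  r≮m rewrite k>n⇒nCk≡0 (s≤s (ℕP.≮⇒≥ r≮m)) = refl

stretch-step : ∀ c Q X (s : ℤ) m r → r ≤ c →
  (∀ q → X (r ℕ.+ q ℕ.* suc c) ≡ s * power Q m q) →
  ∀ q → conv (stretch c Q) X (r ℕ.+ q ℕ.* suc c) ≡ s * power Q (suc m) q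
stretch-step c Q X s m r r≤c X≡ q = begin
  conv (stretch c Q) X (r ℕ.+ q ℕ.* suc c)         ≡⟨ conv-stretch c Q X r r≤c q ⟩
  conv Q (λ t → X (r ℕ.+ t ℕ.* suc c)) q           ≡⟨ conv-cong (λ _ → refl) X≡ q ⟩
  conv Q (λ t → s * power Q m t) q                 ≡⟨ conv-scaleʳ Q s (power Q m) q ⟩
  s * power Q (suc m) q                            ∎
  where open ≡-Reasoning

-- Coefficient extraction from (ak + Q(k^{c+1}))^m for m ≤ c: since exponents below c+1
-- keep their residue class, the exponent r + q(c+1) (r ≤ c) arises only from the term
-- C(m,r) (ak)^r Q(k^{c+1})^{m-r}.
binomial-extract : ∀ c a Q m → m ≤ c → ∀ r → r ≤ c → ∀ q →
  power (λ n → linear a n + stretch c Q n) m (r ℕ.+ q ℕ.* suc c)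
    ≡ + (m C r) * (a ^ r * power Q (m ∸ r) q)
binomial-extract c a Q zero    m≤c zero    r≤c zero    = refl
binomial-extract c a Q zero    m≤c zero    r≤c (suc q) = refl
binomial-extract c a Q zero    m≤c (suc r) r≤c q       = refl
binomial-extract c a Q (suc m) m<c zero    r≤c q       = begin
  conv P X (q ℕ.* suc c)
    ≡⟨ conv-distribʳ (linear a) (stretch c Q) X (q ℕ.* suc c) ⟩
  conv (linear a) X (q ℕ.* suc c) + conv (stretch c Q) X (q ℕ.* suc c)
    ≡⟨ cong₂ _+_ (linear-vanishes q) (stretch-step c Q X (+ (m C 0) * 1ℤ) m 0 z≤n (λ q → trans (IH 0 z≤n q) (sym (ℤP.*-assoc (+ (m C 0)) 1ℤ (power Q m q)))) q) ⟩
  0ℤ + + (m C 0) * 1ℤ * power Q (suc m) q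
    ≡⟨ trans (ℤP.+-identityˡ _) (ℤP.*-assoc (+ (m C 0)) 1ℤ (power Q (suc m) q)) ⟩
  + (suc m C 0) * (a ^ 0 * power Q (suc m ∸ 0) q) ∎
  where
  open ≡-Reasoning
  P = λ n → linear a n + stretch c Q n
  X = power P m
  IH = binomial-extract c a Q m (ℕP.<⇒≤ m<c)
  -- the term ak cannot reach residue 0, because m < c forces C(m,c) = 0
  linear-vanishes : ∀ q → conv (linear a) X (q ℕ.* suc c) ≡ 0ℤ
  linear-vanishes zero    = refl
  linear-vanishes (suc q) = begin
    conv (linear a) X (suc (c ℕ.+ q ℕ.* suc c))            ≡⟨ conv-linear a X _ ⟩
    a * X (c ℕ.+ q ℕ.* suc c)                               ≡⟨ cong (a *_) (IH c ℕP.≤-refl q) ⟩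
    a * (+ (m C c) * (a ^ c * power Q (m ∸ c) q))           ≡⟨ cong (λ t → a * (+ t * (a ^ c * power Q (m ∸ c) q))) (k>n⇒nCk≡0 m<c) ⟩
    a * 0ℤ                                                  ≡⟨ ℤP.*-zeroʳ a ⟩
    0ℤ                                                      ∎
binomial-extract c a Q (suc m) m<c (suc r) r≤c q       = begin
  conv P X n
    ≡⟨ conv-distribʳ (linear a) (stretch c Q) X n ⟩
  conv (linear a) X (suc n′) + conv (stretch c Q) X n
    ≡⟨ cong₂ _+_ (trans (conv-linear a X n′) (cong (a *_) (IH r (ℕP.<⇒≤ r≤c) q)))
                 (stretch-step c Q X (+ (m C suc r) * a ^ suc r) (m ∸ suc r) (suc r) r≤c (λ q → trans (IH (suc r) r≤c q) (sym (ℤP.*-assoc (+ (m C suc r)) (a ^ suc r) (power Q (m ∸ suc r) q)))) q) ⟩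
  a * (+ (m C r) * (a ^ r * Y)) + + (m C suc r) * a ^ suc r * power Q (suc (m ∸ suc r)) q
    ≡⟨ cong (λ t → a * (+ (m C r) * (a ^ r * Y)) + t) (trans (ℤP.*-assoc (+ (m C suc r)) (a ^ suc r) (power Q (suc (m ∸ suc r)) q)) (binomial-∸ m r (λ j → a ^ suc r * power Q j q))) ⟩
  a * (+ (m C r) * (a ^ r * Y)) + + (m C suc r) * (a ^ suc r * Y)
    ≡⟨ regroup (+ (m C r)) (+ (m C suc r)) a (a ^ r) Y ⟩
  (+ (m C r) + + (m C suc r)) * (a ^ suc r * Y)
    ≡⟨ cong (λ t → t * (a ^ suc r * Y)) pascal ⟩
  + (suc m C suc r) * (a ^ suc r * Y) ∎
  where
  open ≡-Reasoning
  P = λ n → linear a n + stretch c Q n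
  X = power P m
  IH = binomial-extract c a Q m (ℕP.<⇒≤ m<c)
  n′ = r ℕ.+ q ℕ.* suc c
  n = suc n′
  Y = power Q (m ∸ r) q
  regroup : ∀ c₁ c₂ x y w → x * (c₁ * (y * w)) + c₂ * (x * y * w) ≡ (c₁ + c₂) * (x * y * w)
  regroup = solve-∀
  pascal : + (m C r) + + (m C suc r) ≡ + (suc m C suc r)
  pascal = trans (sym (ℤP.pos-+ (m C r) (m C suc r))) (cong +_ (nCk+nC[k+1]≡[n+1]C[k+1] m r))

-- inner c h: coefficients of 1 + h₁k + h₂k^{c+1} + ⋯ + h_d k^{(c+1)^{d-1}}, via the
-- recursion  1 + h₁k + h₂k^{c+1} + ⋯ = h₁k + (1 + h₂k + ⋯)(k^{c+1}).
inner : ℕ → ∀ {d} → Vec ℕ d → Series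
inner c []        = unit
inner c (h₁ ∷ h′) = λ n → linear (+ h₁) n + stretch c (inner c h′) n

-- base c a h = ak + (inner c h)(k^{c+1}): the coefficients of 1 + ak + Σᵢ hᵢ k^{(c+1)^i}.
base : ℕ → ℕ → ∀ {d} → Vec ℕ d → Series
base c a h = λ n → linear (+ a) n + stretch c (inner c h) n

monomialSum-cong : ∀ {d} (F : Fin d → ℤ) {E E′ : Fin d → ℕ} → E ≗ E′ → monomialSum F E ≡ monomialSum F E′
monomialSum-cong F E≗E′ =
  cong (λ v → polySum (Vec.toList v)) (VecP.tabulate-cong (λ i → cong (monomial (F i)) (E≗E′ i)))

stretch-monomialSum : ∀ c {d} (F : Fin d → ℤ) (E : Fin d → ℕ) →
  stretch c (coeff (monomialSum F E)) ≗ coeff (monomialSum F (λ i → E i ℕ.* suc c))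
stretch-monomialSum c {zero}  F E n = stretch-zero c n
stretch-monomialSum c {suc d} F E n = begin
  stretch c (coeff (first ⊕ rest)) n                ≡⟨ stretch-cong c (coeff-⊕ first rest) n ⟩
  stretch c (λ i → coeff first i + coeff rest i) n  ≡⟨ stretch-+ c (coeff first) (coeff rest) n ⟩
  stretch c (coeff first) n + stretch c (coeff rest) n
    ≡⟨ cong₂ _+_ (stretch-monomial c (F Fin.zero) (E Fin.zero) n) (stretch-monomialSum c (F ∘ Fin.suc) (E ∘ Fin.suc) n) ⟩
  coeff (monomial (F Fin.zero) (E Fin.zero ℕ.* suc c)) n + coeff (monomialSum (F ∘ Fin.suc) (λ i → E (Fin.suc i) ℕ.* suc c)) n
    ≡⟨ sym (coeff-⊕ (monomial (F Fin.zero) (E Fin.zero ℕ.* suc c)) _ n) ⟩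
  coeff (monomialSum F (λ i → E i ℕ.* suc c)) n ∎
  where
  open ≡-Reasoning
  first = monomial (F Fin.zero) (E Fin.zero)
  rest  = monomialSum (F ∘ Fin.suc) (E ∘ Fin.suc)

stretch-inner : ∀ c {d} (h : Vec ℕ d) →
  stretch c (inner c h) ≗ λ n → unit n + coeff (monomialSum (λ i → + Vec.lookup h i) (λ i → suc c ℕ.^ suc (toℕ i))) n
stretch-inner c []        n = trans (stretch-monomial c 1ℤ 0 n) (sym (ℤP.+-identityʳ _))
stretch-inner c (h₁ ∷ h′) n = begin
  stretch c (λ i → linear (+ h₁) i + stretch c (inner c h′) i) n
    ≡⟨ stretch-+ c (linear (+ h₁)) (stretch c (inner c h′)) n ⟩
  stretch c (linear (+ h₁)) n + stretch c (stretch c (inner c h′)) n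
    ≡⟨ cong₂ _+_ (stretch-monomial c (+ h₁) 1 n) (stretch-cong c (stretch-inner c h′) n) ⟩
  coeff (monomial (+ h₁) (1 ℕ.* suc c)) n + stretch c (λ i → unit i + coeff hs′ i) n
    ≡⟨ cong (λ t → coeff (monomial (+ h₁) (1 ℕ.* suc c)) n + t) (stretch-+ c unit (coeff hs′) n) ⟩
  coeff (monomial (+ h₁) (1 ℕ.* suc c)) n + (stretch c unit n + stretch c (coeff hs′) n)
    ≡⟨ cong₂ (λ u v → u + (v + stretch c (coeff hs′) n)) (cong (λ e → coeff (monomial (+ h₁) e) n) (ℕP.*-comm 1 (suc c)))
                                                          (stretch-monomial c 1ℤ 0 n) ⟩
  coeff (monomial (+ h₁) (suc c ℕ.^ 1)) n + (unit n + stretch c (coeff hs′) n)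
    ≡⟨ cong (λ t → coeff (monomial (+ h₁) (suc c ℕ.^ 1)) n + (unit n + t)) (stretch-monomialSum c F′ (λ i → suc c ℕ.^ suc (toℕ i)) n) ⟩
  coeff (monomial (+ h₁) (suc c ℕ.^ 1)) n + (unit n + coeff (monomialSum F′ (λ i → suc c ℕ.^ suc (toℕ i) ℕ.* suc c)) n)
    ≡⟨ cong (λ L → coeff (monomial (+ h₁) (suc c ℕ.^ 1)) n + (unit n + coeff L n)) (monomialSum-cong F′ (λ i → ℕP.*-comm _ (suc c))) ⟩
  coeff (monomial (+ h₁) (suc c ℕ.^ 1)) n + (unit n + coeff hs″ n)
    ≡⟨ regroup (coeff (monomial (+ h₁) (suc c ℕ.^ 1)) n) (unit n) (coeff hs″ n) ⟩
  unit n + (coeff (monomial (+ h₁) (suc c ℕ.^ 1)) n + coeff hs″ n)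
    ≡⟨ cong (λ t → unit n + t) (sym (coeff-⊕ (monomial (+ h₁) (suc c ℕ.^ 1)) hs″ n)) ⟩
  unit n + coeff (monomialSum (λ i → + Vec.lookup (h₁ ∷ h′) i) (λ i → suc c ℕ.^ suc (toℕ i))) n ∎
  where
  open ≡-Reasoning
  F′ = λ i → + Vec.lookup h′ i
  hs′ = monomialSum F′ (λ i → suc c ℕ.^ suc (toℕ i))
  hs″ = monomialSum F′ (λ i → suc c ℕ.^ suc (suc (toℕ i)))
  regroup : ∀ x y z → x + (y + z) ≡ y + (x + z)
  regroup = solve-∀

coeff-basePoly : ∀ l a {d} (h : Vec ℕ d) → coeff (basePoly l a h) ≗ base l a h
coeff-basePoly l a h n = begin
  coeff (monomial 1ℤ 0 ⊕ monomial (+ a) 1 ⊕ hs) n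
    ≡⟨ coeff-⊕ (monomial 1ℤ 0 ⊕ monomial (+ a) 1) hs n ⟩
  coeff (monomial 1ℤ 0 ⊕ monomial (+ a) 1) n + coeff hs n
    ≡⟨ cong (λ t → t + coeff hs n) (coeff-⊕ (monomial 1ℤ 0) (monomial (+ a) 1) n) ⟩
  unit n + linear (+ a) n + coeff hs n
    ≡⟨ regroup (unit n) (linear (+ a) n) (coeff hs n) ⟩
  linear (+ a) n + (unit n + coeff hs n)
    ≡⟨ cong (λ t → linear (+ a) n + t) (sym (stretch-inner l h n)) ⟩
  base l a h n ∎
  where
  open ≡-Reasoning
  hs = monomialSum (λ i → + Vec.lookup h i) (λ i → suc l ℕ.^ suc (toℕ i))
  regroup : ∀ x y z → x + y + z ≡ y + (x + z)
  regroup = solve-∀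

-- N(x ∷ xs) = x + (λ+1)·N(xs): the exponent vector is read in base λ+1.
N-∷ : ∀ l {n} x (xs : Vec ℕ n) → N l (x ∷ xs) ≡ x ℕ.+ N l xs ℕ.* suc l
N-∷ l {n} x xs = cong₂ ℕ._+_ (ℕP.*-identityʳ x) (sum-scale n (Vec.lookup xs) (λ i → suc l ℕ.^ toℕ i))
  where
  sum-scale : ∀ n (g e : Fin n → ℕ) →
    Vec.sum (Vec.tabulate (λ i → g i ℕ.* (suc l ℕ.* e i))) ≡ Vec.sum (Vec.tabulate (λ i → g i ℕ.* e i)) ℕ.* suc l
  sum-scale zero    g e = refl
  sum-scale (suc n) g e =
    trans (cong (λ t → g Fin.zero ℕ.* (suc l ℕ.* e Fin.zero) ℕ.+ t) (sum-scale n (g ∘ Fin.suc) (e ∘ Fin.suc)))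
          (regroup (suc l) (g Fin.zero) (e Fin.zero) _)
    where
    regroup : ∀ b x y z → x ℕ.* (b ℕ.* y) ℕ.+ z ℕ.* b ≡ (x ℕ.* y ℕ.+ z) ℕ.* b
    regroup = ℕSolver.solve-∀

multinomial : ℕ → ∀ {n} → Vec ℕ n → ℕ
multinomial m []       = 1
multinomial m (x ∷ xs) = (m C x) ℕ.* multinomial (m ∸ x) xs

pos-regroup : ∀ c x k y → + c * (+ x * (+ k * + y)) ≡ + (c ℕ.* k) * + (x ℕ.* y)
pos-regroup c x k y = begin
  + c * (+ x * (+ k * + y))   ≡⟨ cong (λ t → + c * (+ x * t)) (sym (ℤP.pos-* k y)) ⟩
  + c * (+ x * + (k ℕ.* y))   ≡⟨ cong (λ t → + c * t) (sym (ℤP.pos-* x (k ℕ.* y))) ⟩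
  + c * + (x ℕ.* (k ℕ.* y))   ≡⟨ sym (ℤP.pos-* c _) ⟩
  + (c ℕ.* (x ℕ.* (k ℕ.* y))) ≡⟨ cong +_ (regroup c x k y) ⟩
  + ((c ℕ.* k) ℕ.* (x ℕ.* y)) ≡⟨ ℤP.pos-* (c ℕ.* k) (x ℕ.* y) ⟩
  + (c ℕ.* k) * + (x ℕ.* y)   ∎
  where
  open ≡-Reasoning
  regroup : ∀ c x k y → c ℕ.* (x ℕ.* (k ℕ.* y)) ≡ (c ℕ.* k) ℕ.* (x ℕ.* y)
  regroup = ℕSolver.solve-∀

power-unit : ∀ j → power unit j 0 ≡ 1ℤ
power-unit zero    = refl
power-unit (suc j) = trans (ℤP.*-identityˡ _) (power-unit j)

≤-∸ : ∀ x s m → x ℕ.+ s ≤ m → s ≤ m ∸ x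
≤-∸ x s m x+s≤m = subst (_≤ m ∸ x) (ℕP.m+n∸m≡n x s) (ℕP.∸-monoˡ-≤ x x+s≤m)

-- Multinomial theorem for the base: for |α| ≤ m ≤ c the coefficient of k^{N(α)} in
-- (1 + ak + Σᵢ hᵢ k^{(c+1)^i})^m is multinomial m α · a^{α₀} h^{α}, by one binomial
-- extraction per variable.
coeff-power-base : ∀ c {d} (h : Vec ℕ d) a (α : Vec ℕ (suc d)) m → Vec.sum α ≤ m → m ≤ c →
  power (base c a h) m (N c α) ≡ + multinomial m α * mono a h α
coeff-power-base c []        a (x ∷ []) m |α|≤m m≤c = begin
  power (base c a []) m (N c (x ∷ []))             ≡⟨ cong (power (base c a []) m) (N-∷ c x []) ⟩
  power (base c a []) m (x ℕ.+ 0 ℕ.* suc c)        ≡⟨ binomial-extract c (+ a) unit m m≤c x x≤c 0 ⟩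
  + (m C x) * ((+ a) ^ x * power unit (m ∸ x) 0)   ≡⟨ cong₂ (λ u v → + (m C x) * (u * v)) (pos-^ a x) (power-unit (m ∸ x)) ⟩
  + (m C x) * (+ (a ℕ.^ x) * 1ℤ)                   ≡⟨ pos-regroup (m C x) (a ℕ.^ x) 1 1 ⟩
  + ((m C x) ℕ.* 1) * + (a ℕ.^ x ℕ.* 1)            ∎
  where
  open ≡-Reasoning
  x≤c : x ≤ c
  x≤c = ℕP.≤-trans (ℕP.m≤m+n x 0) (ℕP.≤-trans |α|≤m m≤c)
coeff-power-base c (h₁ ∷ h′) a (x ∷ α′) m |α|≤m m≤c = begin
  power (base c a (h₁ ∷ h′)) m (N c (x ∷ α′))                ≡⟨ cong (power (base c a (h₁ ∷ h′)) m) (N-∷ c x α′) ⟩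
  power (base c a (h₁ ∷ h′)) m (x ℕ.+ N c α′ ℕ.* suc c)      ≡⟨ binomial-extract c (+ a) (base c h₁ h′) m m≤c x x≤c (N c α′) ⟩
  + (m C x) * ((+ a) ^ x * power (base c h₁ h′) (m ∸ x) (N c α′))
    ≡⟨ cong₂ (λ u v → + (m C x) * (u * v)) (pos-^ a x) (coeff-power-base c h′ h₁ α′ (m ∸ x) |α′|≤m∸x m∸x≤c) ⟩
  + (m C x) * (+ (a ℕ.^ x) * (+ multinomial (m ∸ x) α′ * mono h₁ h′ α′))
    ≡⟨ pos-regroup (m C x) (a ℕ.^ x) (multinomial (m ∸ x) α′) _ ⟩
  + multinomial m (x ∷ α′) * mono a (h₁ ∷ h′) (x ∷ α′) ∎
  where
  open ≡-Reasoning
  x≤c : x ≤ c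
  x≤c = ℕP.≤-trans (ℕP.m≤m+n x _) (ℕP.≤-trans |α|≤m m≤c)
  |α′|≤m∸x : Vec.sum α′ ≤ m ∸ x
  |α′|≤m∸x = ≤-∸ x _ m |α|≤m
  m∸x≤c : m ∸ x ≤ c
  m∸x≤c = ℕP.≤-trans (ℕP.m∸n≤m m x) m≤c

binomial-factorial : ∀ m x → x ≤ m → (m C x) ℕ.* (x ! ℕ.* (m ∸ x) !) ≡ m !
binomial-factorial m x x≤m = begin
  (m C x) ℕ.* (x ! ℕ.* (m ∸ x) !)                                     ≡⟨ cong (ℕ._* (x ! ℕ.* (m ∸ x) !)) (nCk≡n!/k![n-k]! x≤m) ⟩
  (m ! ℕ./ (x ! ℕ.* (m ∸ x) !)) {{nonZero}} ℕ.* (x ! ℕ.* (m ∸ x) !) ≡⟨ m/n*n≡m {{nonZero}} (k![n∸k]!∣n! x≤m) ⟩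
  m !                                                                 ∎
  where
  open ≡-Reasoning
  nonZero : ℕ.NonZero (x ! ℕ.* (m ∸ x) !)
  nonZero = ℕP.m*n≢0 (x !) ((m ∸ x) !) {{ℕP._!≢0 x}} {{ℕP._!≢0 (m ∸ x)}}

multinomial-factorial : ∀ m {n} (α : Vec ℕ n) → Vec.sum α ≤ m →
  multinomial m α ℕ.* ((m ∸ Vec.sum α) ! ℕ.* prodFact α) ≡ m !
multinomial-factorial m []       _     = trans (ℕP.*-identityˡ _) (ℕP.*-identityʳ _)
multinomial-factorial m (x ∷ xs) |α|≤m = begin
  ((m C x) ℕ.* K) ℕ.* ((m ∸ (x ℕ.+ s)) ! ℕ.* (x ! ℕ.* P))
    ≡⟨ cong (λ t → ((m C x) ℕ.* K) ℕ.* (t ! ℕ.* (x ! ℕ.* P))) (sym (ℕP.∸-+-assoc m x s)) ⟩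
  ((m C x) ℕ.* K) ℕ.* (((m ∸ x) ∸ s) ! ℕ.* (x ! ℕ.* P))
    ≡⟨ regroup (m C x) K (((m ∸ x) ∸ s) !) (x !) P ⟩
  (m C x) ℕ.* (x ! ℕ.* (K ℕ.* (((m ∸ x) ∸ s) ! ℕ.* P)))
    ≡⟨ cong (λ t → (m C x) ℕ.* (x ! ℕ.* t)) (multinomial-factorial (m ∸ x) xs (≤-∸ x s m |α|≤m)) ⟩
  (m C x) ℕ.* (x ! ℕ.* (m ∸ x) !)
    ≡⟨ binomial-factorial m x (ℕP.≤-trans (ℕP.m≤m+n x s) |α|≤m) ⟩
  m ! ∎
  where
  open ≡-Reasoning
  K = multinomial (m ∸ x) xs
  s = Vec.sum xs
  P = prodFact xs
  regroup : ∀ c k f y p → (c ℕ.* k) ℕ.* (f ℕ.* (y ℕ.* p)) ≡ c ℕ.* (y ℕ.* (k ℕ.* (f ℕ.* p)))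
  regroup = ℕSolver.solve-∀

κ≡multinomial : ∀ l {n} (α : Vec ℕ n) → Vec.sum α ≤ l → κ l α ≡ multinomial l α
κ≡multinomial l α |α|≤l =
  trans (cong (λ t → (t ℕ./ multDen l α) {{multDen≢0 l α}}) (sym (multinomial-factorial l α |α|≤l)))
        (m*n/n≡m (multinomial l α) (multDen l α) {{multDen≢0 l α}})

-- N(α) ≤ |α|·(λ+1)^d: every entry is weighted by at most (λ+1)^d.
N-bound : ∀ l d (α : Vec ℕ (suc d)) → N l α ≤ Vec.sum α ℕ.* suc l ℕ.^ d
N-bound l zero    (x ∷ []) = ℕP.≤-reflexive (trans (N-∷ l x []) (sym (ℕP.*-identityʳ (x ℕ.+ 0))))
N-bound l (suc d) (x ∷ α′) = begin
  N l (x ∷ α′)                                                 ≡⟨ N-∷ l x α′ ⟩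
  x ℕ.+ N l α′ ℕ.* suc l                                       ≤⟨ ℕP.+-monoʳ-≤ x (ℕP.*-monoˡ-≤ (suc l) (N-bound l d α′)) ⟩
  x ℕ.+ Vec.sum α′ ℕ.* suc l ℕ.^ d ℕ.* suc l                   ≤⟨ ℕP.+-monoˡ-≤ _ (ℕP.m≤m*n x (suc l ℕ.^ suc d) {{ℕP.m^n≢0 (suc l) (suc d)}}) ⟩
  x ℕ.* suc l ℕ.^ suc d ℕ.+ Vec.sum α′ ℕ.* suc l ℕ.^ d ℕ.* suc l ≡⟨ regroup x (Vec.sum α′) (suc l) (suc l ℕ.^ d) ⟩
  (x ℕ.+ Vec.sum α′) ℕ.* suc l ℕ.^ suc d                       ∎
  where
  open ℕP.≤-Reasoning
  regroup : ∀ x s b p → x ℕ.* (b ℕ.* p) ℕ.+ s ℕ.* p ℕ.* b ≡ (x ℕ.+ s) ℕ.* (b ℕ.* p)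
  regroup = ℕSolver.solve-∀

N≤ν : ∀ l d (α : Vec ℕ (suc d)) → Vec.sum α ≤ l → N l α ≤ ν l d
N≤ν l d α |α|≤l = ℕP.≤-trans (N-bound l d α) (ℕP.*-monoˡ-≤ (suc l ℕ.^ d) |α|≤l)

foldr-+-cong : ∀ {A : Set} {P : A → Set} (f g : A → ℤ) → (∀ x → P x → f x ≡ g x) → ∀ {xs} → All P xs →
  List.foldr (λ x s → f x + s) 0ℤ xs ≡ List.foldr (λ x s → g x + s) 0ℤ xs
foldr-+-cong f g f≡g []         = refl
foldr-+-cong f g f≡g (px ∷ pxs) = cong₂ _+_ (f≡g _ px) (foldr-+-cong f g f≡g pxs)

-- Each term ρ_α k^{ν−N(α)} of V picks the coefficient of k^{N(α)} of (1+ak+B)^λ, which is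
-- κ_α a^{α₀}h^{α}; so the coefficient of k^ν in V·(1+ak+B)^λ is R(a,h).
T-ν≡R : ∀ l d ρ a (h : Vec ℕ d) → T l d ρ a h (ν l d) ≡ R l d ρ a h
T-ν≡R l d ρ a h =
  trans (coeff-polySum-⊗ (Idx d l) (λ α → monomial (ρ α) (ν l d ∸ N l α)) Pl (ν l d))
        (foldr-+-cong _ _ term (all-filter (λ α → Vec.sum α ℕ.≤? l) (boxVecs (suc d) l)))
  where
  Pl = pow (basePoly l a h) l
  term : ∀ α → Vec.sum α ≤ l → coeff (monomial (ρ α) (ν l d ∸ N l α) ⊗ Pl) (ν l d) ≡ ρ α * + κ l α * mono a h α
  term α |α|≤l = begin
    coeff (monomial (ρ α) (ν l d ∸ N l α) ⊗ Pl) (ν l d)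
      ≡⟨ cong (coeff (monomial (ρ α) (ν l d ∸ N l α) ⊗ Pl)) (sym (ℕP.m∸n+n≡m (N≤ν l d α |α|≤l))) ⟩
    coeff (monomial (ρ α) (ν l d ∸ N l α) ⊗ Pl) ((ν l d ∸ N l α) ℕ.+ N l α)
      ≡⟨ coeff-monomial-⊗ (ρ α) (ν l d ∸ N l α) Pl (N l α) ⟩
    ρ α * coeff Pl (N l α)
      ≡⟨ cong (ρ α *_) (coeff-pow (basePoly l a h) (coeff-basePoly l a h) l (N l α)) ⟩
    ρ α * power (base l a h) l (N l α)
      ≡⟨ cong (ρ α *_) (coeff-power-base l h a α l |α|≤l ℕP.≤-refl) ⟩
    ρ α * (+ multinomial l α * mono a h α)
      ≡⟨ cong (λ t → ρ α * (+ t * mono a h α)) (sym (κ≡multinomial l α |α|≤l)) ⟩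
    ρ α * (+ κ l α * mono a h α)
      ≡⟨ sym (ℤP.*-assoc (ρ α) (+ κ l α) (mono a h α)) ⟩
    ρ α * + κ l α * mono a h α ∎
    where open ≡-Reasoning

NearMultiple : ℕ → ℕ → ℤ → ℤ → Set
NearMultiple k n S z =
  (- ((+ k) ^ n) ℤ.< + 2 * (S - z * (+ k) ^ suc n)) × (+ 2 * (S - z * (+ k) ^ suc n) ℤ.< (+ k) ^ n)

abs<⇒bounded : ∀ x n → ∣ x ∣ < n → (- (+ n) ℤ.< x) × (x ℤ.< + n)
abs<⇒bounded (+ m)    (suc n) m<n       = ℤ.-<+ , ℤ.+<+ m<n
abs<⇒bounded -[1+ m ] (suc n) (s≤s m<n) = ℤ.-<- m<n , ℤ.-<+

bounded⇒abs< : ∀ x n → - (+ n) ℤ.< x → x ℤ.< + n → ∣ x ∣ < n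
bounded⇒abs< (+ m)    n       _           (ℤ.+<+ m<n) = m<n
bounded⇒abs< -[1+ m ] (suc n) (ℤ.-<- m<n) _            = s≤s m<n
bounded⇒abs< -[1+ m ] zero    ()          _

abs-cancel-< : ∀ n x c → ∣ + n * x ∣ < n ℕ.* c → ∣ x ∣ < c
abs-cancel-< n x c lt = ℕP.*-cancelˡ-< n ∣ x ∣ c (subst (_< n ℕ.* c) (ℤP.abs-* (+ n) x) lt)

abs<1⇒0 : ∀ x → ∣ x ∣ < 1 → x ≡ 0ℤ
abs<1⇒0 x (s≤s ∣x∣≤0) = ℤP.∣i∣≡0⇒i≡0 (ℕP.n≤0⇒n≡0 ∣x∣≤0)

close-multiple : ∀ A Y X w → ∣ Y ∣ < A → ∣ X ∣ < A → Y - X ≡ + A * (+ 2 * w) → w ≡ 0ℤ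
close-multiple A Y X w |Y|<A |X|<A Y-X≡ =
  abs<1⇒0 w (abs-cancel-< 2 w 1 (abs-cancel-< A (+ 2 * w) 2
    (subst₂ _<_ (cong ∣_∣ Y-X≡) (double A) (ℕP.≤-<-trans (ℤP.∣i-j∣≤∣i∣+∣j∣ Y X) (ℕP.+-mono-< |Y|<A |X|<A)))))
  where
  double : ∀ A → A ℕ.+ A ≡ A ℕ.* 2
  double = ℕSolver.solve-∀

small-plus-multiple : ∀ k t d → ∣ t ∣ < k → t + + k * d ≡ 0ℤ → t ≡ 0ℤ
small-plus-multiple k t d |t|<k t+kd≡0 = begin
  t                 ≡⟨ add-sub t (+ k * d) ⟩
  t + + k * d - + k * d ≡⟨ cong₂ (λ u v → u - + k * v) t+kd≡0 d≡0 ⟩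
  0ℤ - + k * 0ℤ     ≡⟨ zero-minus (+ k) ⟩
  0ℤ                ∎
  where
  open ≡-Reasoning
  add-sub : ∀ x y → x ≡ x + y - y
  add-sub = solve-∀
  zero-minus : ∀ K → 0ℤ - K * 0ℤ ≡ 0ℤ
  zero-minus = solve-∀
  kd≡-t : + k * d ≡ - t
  kd≡-t = begin
    + k * d         ≡⟨ add-sub (+ k * d) t ⟩
    + k * d + t - t ≡⟨ cong (λ u → u - t) (trans (ℤP.+-comm (+ k * d) t) t+kd≡0) ⟩
    0ℤ - t          ≡⟨ ℤP.+-identityˡ (- t) ⟩
    - t             ∎
  d≡0 : d ≡ 0ℤ
  d≡0 = abs<1⇒0 d (abs-cancel-< k d 1
          (subst₂ _<_ (sym (trans (cong ∣_∣ kd≡-t) (ℤP.∣-i∣≡∣i∣ t))) (sym (ℕP.*-identityʳ k)) |t|<k))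

lowPart : ℤ → ℕ → Poly → ℤ
lowPart x zero    p       = 0ℤ
lowPart x (suc n) []      = 0ℤ
lowPart x (suc n) (c ∷ p) = c + x * lowPart x n p

eval-split : ∀ x n p → eval p x ≡ lowPart x n p + x ^ n * (coeff p n + x * eval (List.drop (suc n) p) x)
eval-split x zero    []      = regroup x
  where
  regroup : ∀ x → 0ℤ ≡ 0ℤ + 1ℤ * (0ℤ + x * 0ℤ)
  regroup = solve-∀
eval-split x zero    (c ∷ p) = regroup c x (eval p x)
  where
  regroup : ∀ c x e → c + x * e ≡ 0ℤ + 1ℤ * (c + x * e)
  regroup = solve-∀
eval-split x (suc n) []      = regroup x (x ^ n)
  where
  regroup : ∀ x y → 0ℤ ≡ 0ℤ + x * y * (0ℤ + x * 0ℤ)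
  regroup = solve-∀
eval-split x (suc n) (c ∷ p) =
  trans (cong (λ e → c + x * e) (eval-split x n p))
        (regroup c x (lowPart x n p) (x ^ n) (coeff p n) (eval (List.drop (suc n) p) x))
  where
  regroup : ∀ c x L y t H → c + x * (L + y * (t + x * H)) ≡ c + x * L + x * y * (t + x * H)
  regroup = solve-∀

lowPart-bound : ∀ k n p → 0 < k → (∀ i → i < n → ∣ + 2 * coeff p i ∣ < k) →
  ∣ + 2 * lowPart (+ k) n p ∣ < k ℕ.^ n
lowPart-bound k zero    p       0<k balanced = s≤s z≤n
lowPart-bound k (suc n) []      0<k balanced = ℕP.m^n>0 k {{ℕ.>-nonZero 0<k}} (suc n)
lowPart-bound k (suc n) (c ∷ p) 0<k balanced = begin-strict
  ∣ + 2 * (c + + k * L) ∣             ≡⟨ cong ∣_∣ (regroup c (+ k) L) ⟩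
  ∣ + 2 * c + + k * (+ 2 * L) ∣       ≤⟨ ℤP.∣i+j∣≤∣i∣+∣j∣ (+ 2 * c) (+ k * (+ 2 * L)) ⟩
  ∣ + 2 * c ∣ ℕ.+ ∣ + k * (+ 2 * L) ∣ ≡⟨ cong (λ t → ∣ + 2 * c ∣ ℕ.+ t) (ℤP.abs-* (+ k) (+ 2 * L)) ⟩
  ∣ + 2 * c ∣ ℕ.+ k ℕ.* ∣ + 2 * L ∣   <⟨ ℕP.+-monoˡ-< (k ℕ.* ∣ + 2 * L ∣) (balanced 0 (s≤s z≤n)) ⟩
  k ℕ.+ k ℕ.* ∣ + 2 * L ∣             ≡⟨ sym (ℕP.*-suc k _) ⟩
  k ℕ.* suc ∣ + 2 * L ∣               ≤⟨ ℕP.*-monoʳ-≤ k (lowPart-bound k n p 0<k (λ i i<n → balanced (suc i) (s≤s i<n))) ⟩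
  k ℕ.* k ℕ.^ n                       ∎
  where
  open ℕP.≤-Reasoning
  L = lowPart (+ k) n p
  regroup : ∀ c k L → + 2 * (c + k * L) ≡ + 2 * c + k * (+ 2 * L)
  regroup = solve-∀

-- A coefficient list whose digits 0,…,n are balanced (|2pᵢ| < k).  Writing
-- p(k) = L + kⁿ(pₙ + kH) with |2L| < kⁿ, the digit pₙ is read off from p(k).
module BalancedDigits (p : Poly) (k n : ℕ) (balanced : ∀ i → i ≤ n → ∣ + 2 * coeff p i ∣ < k) where

  private
    K = + k
    L = lowPart K n p
    t = coeff p n
    H = eval (List.drop (suc n) p) K
    A = k ℕ.^ n

    Kⁿ≡A : K ^ n ≡ + A
    Kⁿ≡A = pos-^ k n

    |2L|<A : ∣ + 2 * L ∣ < A
    |2L|<A = lowPart-bound k n p (ℕP.≤-<-trans z≤n (balanced 0 z≤n)) (λ i i<n → balanced i (ℕP.<⇒≤ i<n))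

    split : eval p K ≡ L + K ^ n * (t + K * H)
    split = eval-split K n p

  -- A vanishing digit leaves p(k) = L + k^{n+1}H, within kⁿ/2 of the multiple H k^{n+1}.
  digit-zero⇒near : t ≡ 0ℤ → ∃ (NearMultiple k n (eval p K))
  digit-zero⇒near t≡0 =
    H , subst (λ u → (- u ℤ.< Y) × (Y ℤ.< u)) (sym Kⁿ≡A) (abs<⇒bounded Y A (subst (λ u → ∣ u ∣ < A) (sym Y≡2L) |2L|<A))
    where
    Y = + 2 * (eval p K - H * K ^ suc n)
    regroup : ∀ L P K H → + 2 * (L + P * (0ℤ + K * H) - H * (K * P)) ≡ + 2 * L
    regroup = solve-∀
    Y≡2L : Y ≡ + 2 * L
    Y≡2L = begin
      + 2 * (eval p K - H * K ^ suc n)                 ≡⟨ cong (λ e → + 2 * (e - H * K ^ suc n)) split ⟩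
      + 2 * (L + K ^ n * (t + K * H) - H * (K * K ^ n)) ≡⟨ cong (λ u → + 2 * (L + K ^ n * (u + K * H) - H * (K * K ^ n))) t≡0 ⟩
      + 2 * (L + K ^ n * (0ℤ + K * H) - H * (K * K ^ n)) ≡⟨ regroup L (K ^ n) K H ⟩
      + 2 * L                                           ∎
      where open ≡-Reasoning

  -- Conversely 2(p(k) − z k^{n+1}) − 2L = kⁿ·2w with w = pₙ + k(H − z); both terms on
  -- the left are below kⁿ in size, so w = 0, and then |pₙ| < k forces pₙ = 0.
  near⇒digit-zero : ∀ z → NearMultiple k n (eval p K) z → t ≡ 0ℤ
  near⇒digit-zero z (lower , upper) =
    small-plus-multiple k t (H - z) |t|<k (close-multiple A Y (+ 2 * L) w |Y|<A |2L|<A Y-2L≡)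
    where
    open ≡-Reasoning
    Y = + 2 * (eval p K - z * K ^ suc n)
    w = t + K * (H - z)
    regroup : ∀ L P K H t z → + 2 * (L + P * (t + K * H) - z * (K * P)) - + 2 * L ≡ P * (+ 2 * (t + K * (H - z)))
    regroup = solve-∀

    |Y|<A : ∣ Y ∣ < A
    |Y|<A = bounded⇒abs< Y A (subst (λ u → - u ℤ.< Y) Kⁿ≡A lower) (subst (Y ℤ.<_) Kⁿ≡A upper)

    |t|<k : ∣ t ∣ < k
    |t|<k = ℕP.≤-<-trans (subst (∣ t ∣ ≤_) (sym (ℤP.abs-* (+ 2) t)) (ℕP.m≤m+n ∣ t ∣ _)) (balanced n ℕP.≤-refl)

    Y-2L≡ : Y - + 2 * L ≡ + A * (+ 2 * w)
    Y-2L≡ = begin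
      + 2 * (eval p K - z * K ^ suc n) - + 2 * L                 ≡⟨ cong (λ e → + 2 * (e - z * K ^ suc n) - + 2 * L) split ⟩
      + 2 * (L + K ^ n * (t + K * H) - z * (K * K ^ n)) - + 2 * L ≡⟨ regroup L (K ^ n) K H t z ⟩
      K ^ n * (+ 2 * w)                                          ≡⟨ cong (λ u → u * (+ 2 * w)) Kⁿ≡A ⟩
      + A * (+ 2 * w)                                            ∎

digit-vanishes : ∀ p k n → (∀ i → i ≤ n → ∣ + 2 * coeff p i ∣ < k) →
  (coeff p n ≡ 0ℤ) ⇔ ∃ (NearMultiple k n (eval p (+ k)))
digit-vanishes p k n balanced = mk⇔ digit-zero⇒near (λ (z , near) → near⇒digit-zero z near)
  where open BalancedDigits p k n balanced

-- T_ν = R and Σ_ι T_ι k^ι = V(k)(1+ak+b)^λ, so the claim is the digit lemma for the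
-- coefficient list Σ_ι T_ι k^ι at n = ν; the bounds on T_ι for ι ≤ ν are among the
-- hypotheses.
lemma1 : (l d : ℕ) → 1 ℕ.≤ l → 1 ℕ.≤ d →
         (ρ : Vec ℕ (suc d) → ℤ) →
         (a b k : ℕ) (h : Vec ℕ d) →
         (∀ ι → ι ℕ.≤ 2 ℕ.* ν l d → ∣ + 2 ℤ.* T l d ρ a h ι ∣ ℕ.< k) →
         b ≡ B l h k →
         (R l d ρ a h ≡ 0ℤ) ⇔
         ∃ (λ (z : ℤ) →
            (ℤ.- ((+ k) ℤ.^ ν l d) ℤ.<
               + 2 ℤ.* (V l d ρ k ℤ.* (+ 1 ℤ.+ + a ℤ.* + k ℤ.+ + b) ℤ.^ l
                        ℤ.- z ℤ.* (+ k) ℤ.^ suc (ν l d)))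
            ×
            (+ 2 ℤ.* (V l d ρ k ℤ.* (+ 1 ℤ.+ + a ℤ.* + k ℤ.+ + b) ℤ.^ l
                        ℤ.- z ℤ.* (+ k) ℤ.^ suc (ν l d))
               ℤ.< (+ k) ℤ.^ ν l d))
lemma1 l d _ _ ρ a b k h balanced refl =
  subst₂ (λ c S → (c ≡ 0ℤ) ⇔ ∃ (NearMultiple k (ν l d) S))
         (T-ν≡R l d ρ a h)
         (eval-product l d ρ a h k)
         (digit-vanishes (Vpoly l d ρ ⊗ pow (basePoly l a h) l) k (ν l d)
           (λ ι ι≤ν → balanced ι (ℕP.≤-trans ι≤ν (ℕP.m≤m+n (ν l d) _))))
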